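{- Algorithm 3 (described in the context), run on a non-oriented ring of $n$ nodes with unique IDs, elects a leader and consistently orients the ring, with a total of $n(4\cdot\mathrm{ID}_{\max}-1)$ pulses sent. It achieves quiescence but does not terminate.
   Context: Content-oblivious model: ring of $n$ nodes, each with Port 0 and Port 1, connected to its two neighbours in an arbitrary (non-oriented) way; messages are content-free pulses; asynchronous delivery with arbitrary finite delays, no loss or injection; each port has an incoming queue. Each node $v$ has a unique ID $\mathrm{ID}(v)$, a positive integer; $\mathrm{ID}_{\max}=\max_v\mathrm{ID}(v)$. For $i\in\{0,1\}$, $\rho_i(v)$ is the number of pulses node $v$ has consumed from the queue of Port $i$. Algorithm 3 at node $v$: for $i\in\{0,1\}$, set $\mathrm{ID}^{(i)}(v)=2\,\mathrm{ID}(v)-1+i$ and send one pulse on Port $i$. Then forever repeat: for $i\in\{0,1\}$: if a pulse is waiting at Port $1-i$, consume it (incrementing $\rho_{1-i}$), and if now $\rho_{1-i}\neq \mathrm{ID}^{(i)}(v)$, send one pulse on Port $i$. Then, if $\max(\rho_0,\rho_1)\ge \mathrm{ID}^{(1)}(v)$: set state to Leader if $\rho_0=\mathrm{ID}^{(1)}(v)$ and $\rho_1<\mathrm{ID}^{(1)}(v)$, and to Non-Leader otherwise; and if $\rho_0>\rho_1$ declare Port 1 as the clockwise port (Port 0 as counterclockwise), else declare Port 0 as clockwise (Port 1 as counterclockwise). Quiescence: no pulses in transit (sent but not yet consumed). "Elects a leader and consistently orients the ring" means: once quiescence is reached, exactly one node has state Leader and all others Non-Leader, and the declared clockwise ports are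 consistent, i.e., starting from any node and repeatedly moving to the neighbour at the declared clockwise port passes through all edges of the ring. -}

module Defs where

open import Data.Nat using (ℕ; zero; suc; _+_; _*_; _∸_; _≤_; _<_; _⊔_; _≟_; NonZero)
open import Data.Nat.DivMod using (_%_; m%n<n)
open import Data.Bool using (Bool; true; false; not; if_then_else_)
open import Data.Fin using (Fin; toℕ; fromℕ<)
open import Data.Fin.Properties using () renaming (_≟_ to _≟ᶠ_)
open import Data.Bool.Properties using () renaming (_≟_ to _≟ᵇ_)
open import Data.List using (List; foldr; map; allFin)
open import Data.Maybe using (Maybe; just; nothing)
open import Data.Product using (Σ; _×_; _,_; ∃)
open import Relation.Nullary using (¬_; yes; no; does)
open import Relation.Binary.PropositionalEquality using (_≡_; _≢_)

-- Ports are Bool: false = Port 0, true = Port 1.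
-- A non-oriented ring is given by  o : Fin n → Bool, where  o k  is the
-- port of node k that is connected to node (next k); the other port of
-- node k is connected to node (prev k).  Every wiring of a ring of n
-- nodes arises this way (after naming the nodes along the cycle).
-- Edge number k is the edge between port (o k) of node k and port
-- (not (o (next k))) of node (next k).

module _ (n : ℕ) .{{_ : NonZero n}} where

  next : Fin n → Fin n
  next k = fromℕ< (m%n<n (suc (toℕ k)) n)

  prev : Fin n → Fin n
  prev k = fromℕ< (m%n<n (toℕ k + (n ∸ 1)) n)

Port : Set
Port = Bool

portℕ : Port → ℕ
portℕ false = 0
portℕ true  = 1

IDp : ℕ → Port → ℕ
IDp id i = 2 * id ∸ 1 + portℕ i

IDmax : (n : ℕ) → (Fin n → ℕ) → ℕ
IDmax n ID = foldr _⊔_ 0 (map ID (allFin n))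

data Status : Set where
  undecided leader nonLeader : Status

record NodeState : Set where
  constructor mkNode
  field
    ρ      : Port → ℕ          -- ρ_i : pulses consumed from Port i
    status : Status
    cw     : Maybe Port
open NodeState public

-- Global configuration: node states, pulses in transit towards each
-- (node, incoming port), pulses waiting in the incoming queue of each
-- (node, port), and the total number of pulses sent so far.
record Config (n : ℕ) : Set where
  constructor mkConfig
  field
    node    : Fin n → NodeState
    transit : Fin n → Port → ℕ
    queue   : Fin n → Port → ℕ
    sent    : ℕ
open Config public

upd : ∀ {n} {A : Set} → (Fin n → Port → A) → Fin n → Port → (A → A) → Fin n → Port → A
upd f v p g w q = if does (w ≟ᶠ v) then (if does (q ≟ᵇ p) then g (f w q) else f w q) else f w q

updNode : ∀ {n} → (Fin n → NodeState) → Fin n → NodeState → Fin n → NodeState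
updNode f v s w = if does (w ≟ᶠ v) then s else f w

module Alg (n : ℕ) .{{_ : NonZero n}} (o : Fin n → Port) (ID : Fin n → ℕ) where

  destNode : Fin n → Port → Fin n
  destNode v p = if does (p ≟ᵇ o v) then next n v else prev n v

  destPort : Fin n → Port → Port
  destPort v p = if does (p ≟ᵇ o v) then not (o (next n v)) else o (prev n v)

  send : Fin n → Port → Config n → Config n
  send v p c = record c
    { transit = upd (transit c) (destNode v p) (destPort v p) suc
    ; sent    = suc (sent c) }

  initConfig : Config n
  initConfig = foldr (λ v c → send v true (send v false c))
                     (mkConfig (λ _ → mkNode (λ _ → 0) undecided nothing)
                               (λ _ _ → 0) (λ _ _ → 0) 0)
                     (allFin n)

  setρ : (Port → ℕ) → Port → ℕ → Port → ℕ
  setρ r p x q = if does (q ≟ᵇ p) then x else r q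

  bodyI : Fin n → Port → Config n → Config n
  bodyI v i c with queue c v (not i)
  ... | zero  = c
  ... | suc k =
    let s  = node c v
        r' = suc (ρ s (not i))
        c' = record c
               { node  = updNode (node c) v (record s { ρ = setρ (ρ s) (not i) r' })
               ; queue = upd (queue c) v (not i) (λ _ → k) }
    in if does (r' ≟ IDp (ID v) i) then c' else send v i c'

  decideState : ℕ → NodeState → NodeState
  decideState id s =
    let r0 = ρ s false ; r1 = ρ s true ; I1 = IDp id true in
    if does (I1 Data.Nat.≤? (r0 ⊔ r1))
      then record s
        { status = if does (r0 ≟ I1) then (if does (suc r1 Data.Nat.≤? I1) then leader else nonLeader) else nonLeader
        ; cw     = just (if does (suc r1 Data.Nat.≤? r0) then true else false) }
      else s

  decide : Fin n → Config n → Config n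
  decide v c = record c { node = updNode (node c) v (decideState (ID v) (node c v)) }

  iteration : Fin n → Config n → Config n
  iteration v c = decide v (bodyI v true (bodyI v false c))

  data Event : Set where
    act     : Fin n → Event
    deliver : Fin n → Port → Event

  step : Event → Config n → Config n
  step (act v) c = iteration v c
  step (deliver v p) c with transit c v p
  ... | zero  = c
  ... | suc k = record c { transit = upd (transit c) v p (λ _ → k)
                         ; queue   = upd (queue c) v p suc }

  run : (ℕ → Event) → ℕ → Config n
  run sch zero    = initConfig
  run sch (suc t) = step (sch t) (run sch t)

  -- fairness: every event occurs infinitely often (each node keeps
  -- running its loop; every pulse is delivered after finite delay)
  Fair : (ℕ → Event) → Set
  Fair sch = ∀ e t → Σ ℕ λ t' → t ≤ t' × sch t' ≡ e

  Quiescent : Config n → Set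
  Quiescent c = ∀ v p → transit c v p ≡ 0 × queue c v p ≡ 0

  walk : (Fin n → Port) → Fin n → ℕ → Fin n
  walk d u zero    = u
  walk d u (suc m) = destNode (walk d u m) (d (walk d u m))

  edgeAt : (Fin n → Port) → Fin n → ℕ → Fin n
  edgeAt d u m = let w = walk d u m in
    if does (d w ≟ᵇ o w) then w else prev n w

  ConsistentOrientation : (Fin n → Port) → Set
  ConsistentOrientation d = ∀ u e → Σ ℕ λ m → edgeAt d u m ≡ e

  UniqueLeader : Config n → Set
  UniqueLeader c = Σ (Fin n) λ ℓ →
    status (node c ℓ) ≡ leader × (∀ v → v ≢ ℓ → status (node c v) ≡ nonLeader)

  OrientedRing : Config n → Set
  OrientedRing c = Σ (Fin n → Port) λ d →
    (∀ v → cw (node c v) ≡ just (d v)) × ConsistentOrientation d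

module Submission where

-- A node forwards every pulse it consumes at one port on the other port,
-- except the ID^(i)-th one, so the pulses it has emitted on a port are a
-- function of those it has consumed at the opposite port.  Pulses sent on
-- ports facing the same way around the ring keep travelling that way, and
-- every node stops forwarding them at its threshold, the largest of which
-- belongs to the node ℓ of maximum identifier.  Hence no port ever sees
-- more pulses than ℓ's threshold for its direction; consumption and delivery
-- counts only grow and are bounded, so a fair schedule reaches quiescence.
-- At quiescence the number of pulses received in one direction can only grow
-- along the ring, which is a cycle, so it is the same at all nodes, and ℓ has
-- absorbed the last one: it equals ℓ's threshold 2 ID_max - 1 + i.  So every
-- port has emitted exactly that many pulses, n (4 ID_max - 1) in all, ℓ alone
-- finds ρ_0 = ID^(1), and all nodes point clockwise the way ℓ's Port 1 does.

open import Data.Bool using (true; false; not; if_then_else_; T)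
open import Data.Bool.Properties using (¬-not; not-¬; not-involutive; not-injective) renaming (_≟_ to _≟ᵇ_)
open import Data.Fin using (Fin; zero; suc; toℕ)
open import Data.Fin.Properties using (toℕ-injective; toℕ-fromℕ<; toℕ<n; all?; ¬∀⟶∃¬) renaming (_≟_ to _≟ᶠ_)
open import Data.List using ([]; _∷_; foldr; tabulate; allFin)
open import Data.List.Properties using (map-tabulate)
open import Data.Maybe using (just; nothing)
open import Data.Nat
  using (ℕ; zero; suc; _+_; _*_; _∸_; _≤_; _<_; _⊔_; _≡ᵇ_; _≤ᵇ_; z≤n; s≤s; z<s; NonZero; >-nonZero⁻¹)
open import Data.Nat.DivMod using (_%_; m<n⇒m%n≡m; %-distribˡ-+; m%n%n≡m%n; [m+n]%n≡m%n)
open import Data.Nat.GeneralisedArithmetic using (fold; fold-+)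
open import Data.Nat.Properties
open import Algebra.Properties.CommutativeSemigroup +-commutativeSemigroup using (xy∙z≈xz∙y)
open import Algebra.Properties.Monoid.Sum +-0-monoid using (sum; sum-cong-≗)
open import Data.Nat.Tactic.RingSolver using (solve-∀)
open import Data.Product using (Σ; ∃-syntax; _×_; _,_; proj₁; proj₂)
open import Data.Sum using (_⊎_; inj₁; inj₂)
open import Data.Unit using (tt)
open import Function using (_∘_; id)
open import Function.Definitions using (Injective)
open import Relation.Binary.PropositionalEquality
  using (_≡_; _≢_; refl; sym; trans; cong; cong₂; subst; subst₂; module ≡-Reasoning)
open import Relation.Nullary using (¬_; Dec; yes; no; does; contradiction)
open import Relation.Nullary.Decidable using (dec-true; dec-false; _×-dec_)

open import Defs

-- Finite sums

sum-const : ∀ {n} a → sum {n} (λ _ → a) ≡ n * a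
sum-const {zero}  a = refl
sum-const {suc n} a = cong (a +_) (sum-const {n} a)

sum-mono-≤ : ∀ {n} {f g : Fin n → ℕ} → (∀ i → f i ≤ g i) → sum f ≤ sum g
sum-mono-≤ {zero}  f≤g = z≤n
sum-mono-≤ {suc n} f≤g = +-mono-≤ (f≤g zero) (sum-mono-≤ (λ i → f≤g (suc i)))

sum-mono-< : ∀ {n} {f g : Fin n → ℕ} → (∀ i → f i ≤ g i) → ∀ j → f j < g j → sum f < sum g
sum-mono-< {suc n} f≤g zero    fj<gj = +-mono-<-≤ fj<gj (sum-mono-≤ (λ i → f≤g (suc i)))
sum-mono-< {suc n} f≤g (suc j) fj<gj = +-mono-≤-< (f≤g zero) (sum-mono-< (λ i → f≤g (suc i)) j fj<gj)

term≤sum : ∀ {n} (f : Fin n → ℕ) j → f j ≤ sum f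
term≤sum {suc n} f zero    = m≤m+n _ _
term≤sum {suc n} f (suc j) = ≤-trans (term≤sum (λ i → f (suc i)) j) (m≤n+m _ _)

sum-update : ∀ {n} {f g : Fin n → ℕ} j a →
  (∀ i → i ≢ j → g i ≡ f i) → g j ≡ f j + a → sum g ≡ sum f + a
sum-update {suc n} {f} {g} zero a rest gj = begin
  g zero + sum (λ i → g (suc i)) ≡⟨ cong₂ _+_ gj (sum-cong-≗ (λ i → rest (suc i) λ ())) ⟩
  f zero + a + sum (λ i → f (suc i)) ≡⟨ xy∙z≈xz∙y (f zero) a _ ⟩
  f zero + sum (λ i → f (suc i)) + a ∎
  where open ≡-Reasoning
sum-update {suc n} {f} {g} (suc j) a rest gj = begin
  g zero + sum (λ i → g (suc i)) ≡⟨ cong₂ _+_ (rest zero λ ()) (sum-update j a (λ i i≢j → rest (suc i) (λ { refl → i≢j refl })) gj) ⟩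
  f zero + (sum (λ i → f (suc i)) + a) ≡⟨ +-assoc (f zero) _ a ⟨
  f zero + sum (λ i → f (suc i)) + a ∎
  where open ≡-Reasoning

portSum : (Port → ℕ) → ℕ
portSum g = g false + g true

sum² : ∀ {n} → (Fin n → Port → ℕ) → ℕ
sum² f = sum (λ v → portSum (f v))

sum²-cong : ∀ {n} {f g : Fin n → Port → ℕ} → (∀ v p → f v p ≡ g v p) → sum² f ≡ sum² g
sum²-cong f≡g = sum-cong-≗ (λ v → cong₂ _+_ (f≡g v false) (f≡g v true))

sum²-mono-≤ : ∀ {n} {f g : Fin n → Port → ℕ} → (∀ v p → f v p ≤ g v p) → sum² f ≤ sum² g
sum²-mono-≤ f≤g = sum-mono-≤ (λ v → +-mono-≤ (f≤g v false) (f≤g v true))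

sum²-mono-< : ∀ {n} {f g : Fin n → Port → ℕ} → (∀ v p → f v p ≤ g v p) →
  ∀ w q → f w q < g w q → sum² f < sum² g
sum²-mono-< f≤g w false lt = sum-mono-< (λ v → +-mono-≤ (f≤g v false) (f≤g v true)) w (+-mono-<-≤ lt (f≤g w true))
sum²-mono-< f≤g w true  lt = sum-mono-< (λ v → +-mono-≤ (f≤g v false) (f≤g v true)) w (+-mono-≤-< (f≤g w false) lt)

sum²-update : ∀ {n} {f g : Fin n → Port → ℕ} w q a →
  (∀ v p → ¬ (v ≡ w × p ≡ q) → g v p ≡ f v p) → g w q ≡ f w q + a → sum² g ≡ sum² f + a
sum²-update {f = f} {g} w q a rest gwq =
  sum-update w a (λ v v≢w → cong₂ _+_ (rest v false (v≢w ∘ proj₁)) (rest v true (v≢w ∘ proj₁))) (at q rest gwq)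
  where
  at : ∀ q → (∀ v p → ¬ (v ≡ w × p ≡ q) → g v p ≡ f v p) → g w q ≡ f w q + a →
       portSum (g w) ≡ portSum (f w) + a
  at false rest gwq rewrite gwq | rest w true (λ ()) = xy∙z≈xz∙y (f w false) a (f w true)
  at true  rest gwq rewrite gwq | rest w false (λ ()) = sym (+-assoc (f w false) (f w true) a)

-- Iterating a map

fold-suc : ∀ {A : Set} (z : A) s k → fold z s (suc k) ≡ fold (s z) s k
fold-suc z s k = trans (cong (fold z s) (+-comm 1 k)) (fold-+ z s k)

fold-inverse : ∀ {A : Set} {s t : A → A} → (∀ x → t (s x) ≡ x) →
  ∀ k x → fold (fold x s k) t k ≡ x
fold-inverse t∘s≗id zero    x = refl
fold-inverse {s = s} {t} t∘s≗id (suc k) x = begin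
  fold (s y) t (suc k) ≡⟨ fold-suc (s y) t k ⟩
  fold (t (s y)) t k   ≡⟨ cong (λ z → fold z t k) (t∘s≗id y) ⟩
  fold y t k           ≡⟨ fold-inverse t∘s≗id k x ⟩
  x                    ∎
  where
  open ≡-Reasoning
  y = fold x s k

Cyclic : ∀ {A : Set} → (A → A) → Set
Cyclic f = ∀ u w → ∃[ k ] fold u f k ≡ w

cyclic-inverse : ∀ {A : Set} {s t : A → A} → (∀ x → t (s x) ≡ x) → Cyclic s → Cyclic t
cyclic-inverse {s = s} {t} t∘s≗id s-cyclic u w with s-cyclic w u
... | k , refl = k , fold-inverse t∘s≗id k w

fold-mono-≤ : ∀ {A : Set} {f : A → A} (g : A → ℕ) → (∀ v → g v ≤ g (f v)) → ∀ u k → g u ≤ g (fold u f k)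
fold-mono-≤ g g≤g∘f u zero    = ≤-refl
fold-mono-≤ g g≤g∘f u (suc k) = ≤-trans (fold-mono-≤ g g≤g∘f u k) (g≤g∘f _)

cyclic-mono⇒const : ∀ {A : Set} {f : A → A} → Cyclic f → (g : A → ℕ) →
  (∀ v → g v ≤ g (f v)) → ∀ u w → g u ≡ g w
cyclic-mono⇒const f-cyclic g g≤g∘f u w = ≤-antisym (increases u w) (increases w u)
  where
  increases : ∀ u w → g u ≤ g w
  increases u w with f-cyclic u w
  ... | k , refl = fold-mono-≤ g g≤g∘f u k

-- The ring of nodes

[m%n+o]%n≡[m+o]%n : ∀ m o n .{{_ : NonZero n}} → (m % n + o) % n ≡ (m + o) % n
[m%n+o]%n≡[m+o]%n m o n = begin
  (m % n + o) % n         ≡⟨ %-distribˡ-+ (m % n) o n ⟩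
  (m % n % n + o % n) % n ≡⟨ cong (λ x → (x + o % n) % n) (m%n%n≡m%n m n) ⟩
  (m % n + o % n) % n     ≡⟨ %-distribˡ-+ m o n ⟨
  (m + o) % n             ∎
  where open ≡-Reasoning

module _ (n : ℕ) .{{_ : NonZero n}} where

  private
    1+[n∸1]≡n : suc (n ∸ 1) ≡ n
    1+[n∸1]≡n = m+[n∸m]≡n (>-nonZero⁻¹ n)

    toℕ-%-idem : ∀ (k : Fin n) → toℕ k % n ≡ toℕ k
    toℕ-%-idem k = m<n⇒m%n≡m (toℕ<n k)

  toℕ-next : ∀ k → toℕ (next n k) ≡ suc (toℕ k) % n
  toℕ-next k = toℕ-fromℕ< _

  toℕ-prev : ∀ k → toℕ (prev n k) ≡ (toℕ k + (n ∸ 1)) % n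
  toℕ-prev k = toℕ-fromℕ< _

  prev-next : ∀ k → prev n (next n k) ≡ k
  prev-next k = toℕ-injective (begin
    toℕ (prev n (next n k))            ≡⟨ toℕ-prev (next n k) ⟩
    (toℕ (next n k) + (n ∸ 1)) % n     ≡⟨ cong (λ x → (x + (n ∸ 1)) % n) (toℕ-next k) ⟩
    (suc (toℕ k) % n + (n ∸ 1)) % n    ≡⟨ [m%n+o]%n≡[m+o]%n (suc (toℕ k)) (n ∸ 1) n ⟩
    suc (toℕ k + (n ∸ 1)) % n          ≡⟨ cong (_% n) (+-suc (toℕ k) _) ⟨
    (toℕ k + suc (n ∸ 1)) % n          ≡⟨ cong (λ x → (toℕ k + x) % n) 1+[n∸1]≡n ⟩
    (toℕ k + n) % n                    ≡⟨ [m+n]%n≡m%n (toℕ k) n ⟩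
    toℕ k % n                          ≡⟨ toℕ-%-idem k ⟩
    toℕ k                              ∎)
    where open ≡-Reasoning

  next-prev : ∀ k → next n (prev n k) ≡ k
  next-prev k = toℕ-injective (begin
    toℕ (next n (prev n k))            ≡⟨ toℕ-next (prev n k) ⟩
    suc (toℕ (prev n k)) % n           ≡⟨ cong (λ x → suc x % n) (toℕ-prev k) ⟩
    suc ((toℕ k + (n ∸ 1)) % n) % n    ≡⟨ cong (_% n) (+-comm 1 _) ⟩
    ((toℕ k + (n ∸ 1)) % n + 1) % n    ≡⟨ [m%n+o]%n≡[m+o]%n (toℕ k + (n ∸ 1)) 1 n ⟩
    (toℕ k + (n ∸ 1) + 1) % n          ≡⟨ cong (_% n) (trans (+-assoc (toℕ k) _ 1) (cong (toℕ k +_) (trans (+-comm (n ∸ 1) 1) 1+[n∸1]≡n))) ⟩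
    (toℕ k + n) % n                    ≡⟨ [m+n]%n≡m%n (toℕ k) n ⟩
    toℕ k % n                          ≡⟨ toℕ-%-idem k ⟩
    toℕ k                              ∎)
    where open ≡-Reasoning

  toℕ-fold-next : ∀ u k → toℕ (fold u (next n) k) ≡ (toℕ u + k) % n
  toℕ-fold-next u zero = sym (trans (cong (_% n) (+-identityʳ (toℕ u))) (toℕ-%-idem u))
  toℕ-fold-next u (suc k) = begin
    toℕ (next n (fold u (next n) k))   ≡⟨ toℕ-next _ ⟩
    suc (toℕ (fold u (next n) k)) % n  ≡⟨ cong (λ x → suc x % n) (toℕ-fold-next u k) ⟩
    suc ((toℕ u + k) % n) % n          ≡⟨ cong (_% n) (+-comm 1 _) ⟩
    ((toℕ u + k) % n + 1) % n          ≡⟨ [m%n+o]%n≡[m+o]%n (toℕ u + k) 1 n ⟩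
    (toℕ u + k + 1) % n                ≡⟨ cong (_% n) (trans (+-assoc (toℕ u) k 1) (cong (toℕ u +_) (+-comm k 1))) ⟩
    (toℕ u + suc k) % n                ∎
    where open ≡-Reasoning

  next-cyclic : Cyclic (next n)
  next-cyclic u w = n ∸ toℕ u + toℕ w , toℕ-injective (begin
    toℕ (fold u (next n) (n ∸ toℕ u + toℕ w)) ≡⟨ toℕ-fold-next u _ ⟩
    (toℕ u + (n ∸ toℕ u + toℕ w)) % n         ≡⟨ cong (_% n) (+-assoc (toℕ u) _ (toℕ w)) ⟨
    (toℕ u + (n ∸ toℕ u) + toℕ w) % n         ≡⟨ cong (λ x → (x + toℕ w) % n) (m+[n∸m]≡n (<⇒≤ (toℕ<n u))) ⟩
    (n + toℕ w) % n                           ≡⟨ cong (_% n) (+-comm n (toℕ w)) ⟩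
    (toℕ w + n) % n                           ≡⟨ [m+n]%n≡m%n (toℕ w) n ⟩
    toℕ w % n                                 ≡⟨ toℕ-%-idem w ⟩
    toℕ w                                     ∎)
    where open ≡-Reasoning

  prev-cyclic : Cyclic (prev n)
  prev-cyclic = cyclic-inverse prev-next next-cyclic

-- Arithmetic of the pulse counts

-- Pulses sent on a port once c pulses have been consumed at the other
-- port: the initial pulse, plus one for every consumption except the
-- a-th.
emitted : (c a : ℕ) → ℕ
emitted c a with a ≤? c
... | yes _ = c
... | no  _ = suc c

c≤emitted : ∀ c a → c ≤ emitted c a
c≤emitted c a with a ≤? c
... | yes _ = ≤-refl
... | no  _ = n≤1+n c

emitted-lub : ∀ {c a b} → c ≤ b → a ≤ b → emitted c a ≤ b
emitted-lub {c} {a} c≤b a≤b with a ≤? c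
... | yes _   = c≤b
... | no  a≰c = ≤-trans (≰⇒> a≰c) a≤b

emitted-saturated : ∀ {c a} → a ≤ c → emitted c a ≡ c
emitted-saturated {c} {a} a≤c with a ≤? c
... | yes _   = refl
... | no  a≰c = contradiction a≤c a≰c

emitted-saturated⁻¹ : ∀ {c a} → emitted c a ≡ c → a ≤ c
emitted-saturated⁻¹ {c} {a} eq with a ≤? c
... | yes a≤c = a≤c
... | no  _   = contradiction eq 1+n≢n

emitted-zero : ∀ {a} → 0 < a → emitted 0 a ≡ 1
emitted-zero {a} 0<a with a ≤? 0
... | yes a≤0 = contradiction a≤0 (<⇒≱ 0<a)
... | no  _   = refl

emitted-suc-threshold : ∀ {c a} → suc c ≡ a → emitted (suc c) a ≡ emitted c a
emitted-suc-threshold {c} refl with suc c ≤? suc c | suc c ≤? c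
... | yes _    | yes c<c = contradiction c<c (<-irrefl refl)
... | yes _    | no  _   = refl
... | no  c≰c  | _       = contradiction ≤-refl c≰c

emitted-suc : ∀ {c a} → suc c ≢ a → emitted (suc c) a ≡ suc (emitted c a)
emitted-suc {c} {a} 1+c≢a with a ≤? suc c | a ≤? c
... | yes _     | yes _   = refl
... | yes a≤1+c | no  a≰c = contradiction (≤-antisym (≰⇒> a≰c) a≤1+c) 1+c≢a
... | no  a≰1+c | yes a≤c = contradiction (m≤n⇒m≤1+n a≤c) a≰1+c
... | no  _     | no  _   = refl

portℕ≤1 : ∀ p → portℕ p ≤ 1
portℕ≤1 false = z≤n
portℕ≤1 true  = s≤s z≤n

IDp-suc : ∀ k p → IDp (suc k) p ≡ suc (2 * k + portℕ p)
IDp-suc k p = cong (λ x → x ∸ 1 + portℕ p) (*-suc 2 k)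

IDp-true : ∀ k → IDp (suc k) true ≡ 2 * suc k
IDp-true k = trans (IDp-suc k true) (trans (cong suc (+-comm (2 * k) 1)) (sym (*-suc 2 k)))

IDp-false<true : ∀ {a} → 0 < a → IDp a false < IDp a true
IDp-false<true {suc k} _ = ≤-reflexive (sym (trans (IDp-suc k true) (cong suc (trans (+-suc (2 * k) 0) (sym (IDp-suc k false))))))

IDp-positive : ∀ {a} p → 0 < a → 0 < IDp a p
IDp-positive {suc k} p _ rewrite IDp-suc k p = s≤s z≤n

IDp≤IDp-true : ∀ {a} p → 0 < a → IDp a p ≤ IDp a true
IDp≤IDp-true {suc k} p _ rewrite IDp-suc k p | IDp-suc k true = s≤s (+-monoʳ-≤ (2 * k) (portℕ≤1 p))

IDp-mono-< : ∀ {a b} p q → 0 < a → a < b → IDp a p < IDp b q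
IDp-mono-< {suc a} {suc b} p q _ (s≤s a<b) = begin-strict
  IDp (suc a) p    ≤⟨ IDp≤IDp-true p z<s ⟩
  IDp (suc a) true ≡⟨ IDp-true a ⟩
  2 * suc a        ≤⟨ *-monoʳ-≤ 2 a<b ⟩
  2 * b            <⟨ s≤s (m≤m+n (2 * b) (portℕ q)) ⟩
  suc (2 * b + portℕ q) ≡⟨ IDp-suc b q ⟨
  IDp (suc b) q    ∎
  where open ≤-Reasoning

IDp-mono-≤ : ∀ {a b} p → a ≤ b → IDp a p ≤ IDp b p
IDp-mono-≤ p a≤b = +-monoˡ-≤ (portℕ p) (∸-monoˡ-≤ 1 (*-monoʳ-≤ 2 a≤b))

IDp-pair : ∀ {a} p → 0 < a → IDp a p + IDp a (not p) ≡ 4 * a ∸ 1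
IDp-pair {suc k} false _ rewrite IDp-suc k false | IDp-suc k true = identity k
  where
  identity : ∀ k → suc (2 * k + 0) + suc (2 * k + 1) ≡ k + 3 * suc k
  identity = solve-∀
IDp-pair {suc k} true  _ rewrite IDp-suc k false | IDp-suc k true = identity k
  where
  identity : ∀ k → suc (2 * k + 1) + suc (2 * k + 0) ≡ k + 3 * suc k
  identity = solve-∀

not≢self : ∀ {b} → not b ≢ b
not≢self = not-¬ refl ∘ sym

module _ {n : ℕ} {A : Set} where

  upd-same : ∀ (f : Fin n → Port → A) v p g → upd f v p g v p ≡ g (f v p)
  upd-same f v p g rewrite dec-true (v ≟ᶠ v) refl | dec-true (p ≟ᵇ p) refl = refl

  upd-other : ∀ (f : Fin n → Port → A) v p g w q → ¬ (w ≡ v × q ≡ p) → upd f v p g w q ≡ f w q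
  upd-other f v p g w q ¬same with w ≟ᶠ v | q ≟ᵇ p
  ... | yes w≡v | yes q≡p = contradiction (w≡v , q≡p) ¬same
  ... | yes _   | no  _   = refl
  ... | no  _   | _       = refl

updNode-same : ∀ {n} (f : Fin n → NodeState) v s → updNode f v s v ≡ s
updNode-same f v s rewrite dec-true (v ≟ᶠ v) refl = refl

updNode-other : ∀ {n} (f : Fin n → NodeState) v s w → w ≢ v → updNode f v s w ≡ f w
updNode-other f v s w w≢v rewrite dec-false (w ≟ᶠ v) w≢v = refl

-- Executions of the algorithm

module Execution (n : ℕ) .{{_ : NonZero n}} (o : Fin n → Port) (ID : Fin n → ℕ) where

  open Alg n o ID

  -- Links are symmetric, so the pulses arriving at port q of w are those
  -- sent on port destPort w q of destNode w q.
  dest-involutive : ∀ v p → destNode (destNode v p) (destPort v p) ≡ v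
                          × destPort (destNode v p) (destPort v p) ≡ p
  dest-involutive v p with p ≟ᵇ o v
  ... | yes p≡ov
    rewrite dec-false (not (o (next n v)) ≟ᵇ o (next n v)) not≢self
    = prev-next n v , trans (cong o (prev-next n v)) (sym p≡ov)
  ... | no  p≢ov
    rewrite dec-true (o (prev n v) ≟ᵇ o (prev n v)) refl
    = next-prev n v , trans (cong (not ∘ o) (next-prev n v)) (sym (¬-not p≢ov))

  linked : ∀ {v p w q} → destNode v p ≡ w → destPort v p ≡ q →
           destNode w q ≡ v × destPort w q ≡ p
  linked {v} {p} refl refl = dest-involutive v p

  setρ-same : ∀ r p x → setρ r p x p ≡ x
  setρ-same r p x rewrite dec-true (p ≟ᵇ p) refl = refl

  setρ-other : ∀ r p x q → q ≢ p → setρ r p x q ≡ r q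
  setρ-other r p x q q≢p rewrite dec-false (q ≟ᵇ p) q≢p = refl

  consumed : Config n → Fin n → Port → ℕ
  consumed c w q = ρ (node c w) q

  delivered : Config n → Fin n → Port → ℕ
  delivered c w q = queue c w q + consumed c w q

  deliverOne : Fin n → Port → ℕ → Config n → Config n
  deliverOne v p k c = record c
    { transit = upd (transit c) v p (λ _ → k)
    ; queue   = upd (queue c) v p suc }

  consumeOne : Fin n → Port → ℕ → Config n → Config n
  consumeOne v j k c = record c
    { node  = updNode (node c) v (record (node c v) { ρ = setρ (ρ (node c v)) j (suc (consumed c v j)) })
    ; queue = upd (queue c) v j (λ _ → k) }

  deliver-cases : ∀ v p c →
      (transit c v p ≡ 0 × step (deliver v p) c ≡ c)
    ⊎ (∃[ k ] transit c v p ≡ suc k × step (deliver v p) c ≡ deliverOne v p k c)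
  deliver-cases v p c with transit c v p
  ... | zero  = inj₁ (refl , refl)
  ... | suc k = inj₂ (k , refl , refl)

  bodyI-cases : ∀ v i c →
      (queue c v (not i) ≡ 0 × bodyI v i c ≡ c)
    ⊎ (∃[ k ] queue c v (not i) ≡ suc k ×
        (  (suc (consumed c v (not i)) ≡ IDp (ID v) i × bodyI v i c ≡ consumeOne v (not i) k c)
         ⊎ (suc (consumed c v (not i)) ≢ IDp (ID v) i × bodyI v i c ≡ send v i (consumeOne v (not i) k c))))
  -- the test  does (_ ≟ _)  in bodyI reduces to _≡ᵇ_, which is what must be abstracted
  bodyI-cases v i c with queue c v (not i)
  ... | zero  = inj₁ (refl , refl)
  ... | suc k with suc (consumed c v (not i)) ≡ᵇ IDp (ID v) i in eq
  ...   | true  = inj₂ (k , refl , inj₁ (≡ᵇ⇒≡ _ _ (subst T (sym eq) tt) , refl))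
  ...   | false = inj₂ (k , refl , inj₂ ((λ e → subst T eq (≡⇒≡ᵇ _ _ e)) , refl))

  consumed-consumeOne-same : ∀ v j k c → consumed (consumeOne v j k c) v j ≡ suc (consumed c v j)
  consumed-consumeOne-same v j k c rewrite updNode-same (node c) v (record (node c v) { ρ = setρ (ρ (node c v)) j (suc (consumed c v j)) }) =
    setρ-same (ρ (node c v)) j _

  consumed-consumeOne-other : ∀ v j k c w q → ¬ (w ≡ v × q ≡ j) → consumed (consumeOne v j k c) w q ≡ consumed c w q
  consumed-consumeOne-other v j k c w q ¬same with w ≟ᶠ v
  ... | yes refl = setρ-other (ρ (node c v)) j _ q (λ q≡j → ¬same (refl , q≡j))
  ... | no  _    = refl

  delivered-consumeOne : ∀ v j k c → queue c v j ≡ suc k → ∀ w q → delivered (consumeOne v j k c) w q ≡ delivered c w q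
  delivered-consumeOne v j k c qv≡1+k w q with (w ≟ᶠ v) ×-dec (q ≟ᵇ j)
  ... | yes (refl , refl) = begin
    upd (queue c) v j (λ _ → k) v j + consumed (consumeOne v j k c) v j
      ≡⟨ cong₂ _+_ (upd-same (queue c) v j (λ _ → k)) (consumed-consumeOne-same v j k c) ⟩
    k + suc (consumed c v j) ≡⟨ +-suc k _ ⟩
    suc k + consumed c v j   ≡⟨ cong (_+ consumed c v j) qv≡1+k ⟨
    delivered c v j          ∎
    where open ≡-Reasoning
  ... | no  ¬same = cong₂ _+_ (upd-other (queue c) v j (λ _ → k) w q ¬same) (consumed-consumeOne-other v j k c w q ¬same)

  transit-send-same : ∀ v p c → transit (send v p c) (destNode v p) (destPort v p) ≡ suc (transit c (destNode v p) (destPort v p))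
  transit-send-same v p c = upd-same (transit c) (destNode v p) (destPort v p) suc

  transit-send-other : ∀ v p c w q → ¬ (w ≡ destNode v p × q ≡ destPort v p) → transit (send v p c) w q ≡ transit c w q
  transit-send-other v p c w q = upd-other (transit c) (destNode v p) (destPort v p) suc w q

  consumed-decide : ∀ v c w q → consumed (decide v c) w q ≡ consumed c w q
  consumed-decide v c w q with w ≟ᶠ v
  ... | no  _    = refl
  ... | yes refl with IDp (ID v) true ≤ᵇ (ρ (node c v) false ⊔ ρ (node c v) true)
  ...   | true  = refl
  ...   | false = refl

  record _⊑_ (c c' : Config n) : Set where
    field
      consumed-mono  : ∀ w q → consumed c w q ≤ consumed c' w q
      delivered-mono : ∀ w q → delivered c w q ≤ delivered c' w q
  open _⊑_

  ⊑-refl : ∀ {c} → c ⊑ c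
  ⊑-refl = record { consumed-mono = λ _ _ → ≤-refl ; delivered-mono = λ _ _ → ≤-refl }

  ⊑-trans : ∀ {c c' c''} → c ⊑ c' → c' ⊑ c'' → c ⊑ c''
  ⊑-trans c⊑c' c'⊑c'' = record
    { consumed-mono  = λ w q → ≤-trans (consumed-mono c⊑c' w q) (consumed-mono c'⊑c'' w q)
    ; delivered-mono = λ w q → ≤-trans (delivered-mono c⊑c' w q) (delivered-mono c'⊑c'' w q) }

  ⊑-consumeOne : ∀ v j k c → queue c v j ≡ suc k → c ⊑ consumeOne v j k c
  ⊑-consumeOne v j k c qv≡1+k = record
    { consumed-mono  = grows
    ; delivered-mono = λ w q → ≤-reflexive (sym (delivered-consumeOne v j k c qv≡1+k w q)) }
    where
    grows : ∀ w q → consumed c w q ≤ consumed (consumeOne v j k c) w q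
    grows w q with (w ≟ᶠ v) ×-dec (q ≟ᵇ j)
    ... | yes (refl , refl) = ≤-trans (n≤1+n _) (≤-reflexive (sym (consumed-consumeOne-same v j k c)))
    ... | no  ¬same         = ≤-reflexive (sym (consumed-consumeOne-other v j k c w q ¬same))

  ⊑-send : ∀ v p {c c'} → c ⊑ c' → c ⊑ send v p c'
  ⊑-send v p c⊑c' = record { consumed-mono = consumed-mono c⊑c' ; delivered-mono = delivered-mono c⊑c' }

  ⊑-bodyI : ∀ v i c → c ⊑ bodyI v i c
  ⊑-bodyI v i c with bodyI-cases v i c
  ... | inj₁ (_ , eq) rewrite eq = ⊑-refl
  ... | inj₂ (k , qv≡1+k , inj₁ (_ , eq)) rewrite eq = ⊑-consumeOne v (not i) k c qv≡1+k
  ... | inj₂ (k , qv≡1+k , inj₂ (_ , eq)) rewrite eq = ⊑-send v i (⊑-consumeOne v (not i) k c qv≡1+k)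

  ⊑-decide : ∀ v c → c ⊑ decide v c
  ⊑-decide v c = record
    { consumed-mono  = λ w q → ≤-reflexive (sym (consumed-decide v c w q))
    ; delivered-mono = λ w q → ≤-reflexive (cong (queue c w q +_) (sym (consumed-decide v c w q))) }

  ⊑-deliverOne : ∀ v p k c → c ⊑ deliverOne v p k c
  ⊑-deliverOne v p k c = record { consumed-mono = λ _ _ → ≤-refl ; delivered-mono = grows }
    where
    grows : ∀ w q → delivered c w q ≤ delivered (deliverOne v p k c) w q
    grows w q with (w ≟ᶠ v) ×-dec (q ≟ᵇ p)
    ... | yes (refl , refl) rewrite upd-same (queue c) v p suc = n≤1+n _
    ... | no  ¬same         rewrite upd-other (queue c) v p suc w q ¬same = ≤-refl

  ⊑-step : ∀ e c → c ⊑ step e c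
  ⊑-step (act v) c = ⊑-trans (⊑-bodyI v false c) (⊑-trans (⊑-bodyI v true _) (⊑-decide v _))
  ⊑-step (deliver v p) c with deliver-cases v p c
  ... | inj₁ (_ , eq)     rewrite eq = ⊑-refl
  ... | inj₂ (k , _ , eq) rewrite eq = ⊑-deliverOne v p k c

  persistent : ∀ sch (P : Config n → Set) {t} →
    (∀ {t'} → t ≤ t' → P (run sch t') → P (run sch (suc t'))) →
    P (run sch t) → ∀ {t'} → t ≤ t' → P (run sch t')
  persistent sch P {t} preserved Pt {t'} t≤t' = subst (P ∘ run sch) (m∸n+n≡m t≤t') (after (t' ∸ t))
    where
    after : ∀ d → P (run sch (d + t))
    after zero    = Pt
    after (suc d) = preserved (m≤n+m t d) (after d)

  ⊑-run : ∀ sch {t t'} → t ≤ t' → run sch t ⊑ run sch t'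
  ⊑-run sch {t} = persistent sch (run sch t ⊑_) (λ {t'} _ c⊑ → ⊑-trans c⊑ (⊑-step (sch t') _)) ⊑-refl

  measure : Config n → ℕ
  measure c = sum² (λ w q → delivered c w q + consumed c w q)

  private
    pointwise : ∀ {c c'} → c ⊑ c' → ∀ w q → delivered c w q + consumed c w q ≤ delivered c' w q + consumed c' w q
    pointwise c⊑c' w q = +-mono-≤ (delivered-mono c⊑c' w q) (consumed-mono c⊑c' w q)

  measure-mono : ∀ {c c'} → c ⊑ c' → measure c ≤ measure c'
  measure-mono c⊑c' = sum²-mono-≤ (pointwise c⊑c')

  measure-mono-<-consumed : ∀ {c c'} → c ⊑ c' → ∀ w q → consumed c w q < consumed c' w q → measure c < measure c'
  measure-mono-<-consumed c⊑c' w q lt = sum²-mono-< (pointwise c⊑c') w q (+-mono-≤-< (delivered-mono c⊑c' w q) lt)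

  measure-mono-<-delivered : ∀ {c c'} → c ⊑ c' → ∀ w q → delivered c w q < delivered c' w q → measure c < measure c'
  measure-mono-<-delivered c⊑c' w q lt = sum²-mono-< (pointwise c⊑c') w q (+-mono-<-≤ lt (consumed-mono c⊑c' w q))

  measure-≡⇒consumed-≡ : ∀ {c c'} → c ⊑ c' → measure c ≡ measure c' → ∀ w q → consumed c w q ≡ consumed c' w q
  measure-≡⇒consumed-≡ c⊑c' eq w q with m≤n⇒m<n∨m≡n (consumed-mono c⊑c' w q)
  ... | inj₁ lt = contradiction eq (<⇒≢ (measure-mono-<-consumed c⊑c' w q lt))
  ... | inj₂ eq' = eq'

  measure-≡⇒delivered-≡ : ∀ {c c'} → c ⊑ c' → measure c ≡ measure c' → ∀ w q → delivered c w q ≡ delivered c' w q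
  measure-≡⇒delivered-≡ c⊑c' eq w q with m≤n⇒m<n∨m≡n (delivered-mono c⊑c' w q)
  ... | inj₁ lt = contradiction eq (<⇒≢ (measure-mono-<-delivered c⊑c' w q lt))
  ... | inj₂ eq' = eq'

  delivered-deliver : ∀ c w q → transit c w q ≢ 0 → delivered c w q < delivered (step (deliver w q) c) w q
  delivered-deliver c w q transit≢0 with deliver-cases w q c
  ... | inj₁ (transit≡0 , _) = contradiction transit≡0 transit≢0
  ... | inj₂ (k , _ , eq) rewrite eq | upd-same (queue c) w q suc = ≤-refl

  consumed-bodyI : ∀ v i c → queue c v (not i) ≢ 0 → consumed (bodyI v i c) v (not i) ≡ suc (consumed c v (not i))
  consumed-bodyI v i c queue≢0 with bodyI-cases v i c
  ... | inj₁ (queue≡0 , _) = contradiction queue≡0 queue≢0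
  ... | inj₂ (k , _ , inj₁ (_ , eq)) rewrite eq = consumed-consumeOne-same v (not i) k c
  ... | inj₂ (k , _ , inj₂ (_ , eq)) rewrite eq = consumed-consumeOne-same v (not i) k c

  queue-bodyI : ∀ v i c → queue (bodyI v i c) v i ≡ queue c v i
  queue-bodyI v i c with bodyI-cases v i c
  ... | inj₁ (_ , eq) rewrite eq = refl
  ... | inj₂ (k , _ , inj₁ (_ , eq)) rewrite eq = upd-other (queue c) v (not i) (λ _ → k) v i (not-¬ refl ∘ proj₂)
  ... | inj₂ (k , _ , inj₂ (_ , eq)) rewrite eq = upd-other (queue c) v (not i) (λ _ → k) v i (not-¬ refl ∘ proj₂)

  -- port true is served by the first half of the loop, port false by the second
  consumed-act : ∀ c w q → queue c w q ≢ 0 → consumed c w q < consumed (step (act w) c) w q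
  consumed-act c w true queue≢0 = begin-strict
    consumed c w true                     <⟨ n<1+n _ ⟩
    suc (consumed c w true)               ≡⟨ consumed-bodyI w false c queue≢0 ⟨
    consumed c₁ w true                    ≤⟨ consumed-mono (⊑-trans (⊑-bodyI w true c₁) (⊑-decide w (bodyI w true c₁))) w true ⟩
    consumed (step (act w) c) w true      ∎
    where
    open ≤-Reasoning
    c₁ = bodyI w false c
  consumed-act c w false queue≢0 = begin-strict
    consumed c w false                    ≤⟨ consumed-mono (⊑-bodyI w false c) w false ⟩
    consumed c₁ w false                   <⟨ n<1+n _ ⟩
    suc (consumed c₁ w false)             ≡⟨ consumed-bodyI w true c₁ (queue≢0 ∘ trans (sym (queue-bodyI w false c))) ⟨
    consumed (bodyI w true c₁) w false    ≡⟨ consumed-decide w (bodyI w true c₁) w false ⟨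
    consumed (step (act w) c) w false     ∎
    where
    open ≤-Reasoning
    c₁ = bodyI w false c

  quiescent-act : ∀ v c → Quiescent c → step (act v) c ≡ decide v c
  quiescent-act v c quiet with bodyI-cases v false c
  ... | inj₂ (_ , queue≡1+k , _) = contradiction (trans (sym queue≡1+k) (proj₂ (quiet v true))) (λ ())
  ... | inj₁ (_ , eq₁) with bodyI-cases v true (bodyI v false c)
  ...   | inj₁ (_ , eq₂) = cong (decide v) (trans eq₂ eq₁)
  ...   | inj₂ (_ , queue≡1+k , _) =
    contradiction (trans (sym queue≡1+k) (trans (cong (λ c' → queue c' v false) eq₁) (proj₂ (quiet v false)))) (λ ())

  quiescent-step : ∀ e c → Quiescent c → step e c ≡ c ⊎ ∃[ v ] step e c ≡ decide v c
  quiescent-step (act v) c quiet = inj₂ (v , quiescent-act v c quiet)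
  quiescent-step (deliver v p) c quiet with deliver-cases v p c
  ... | inj₁ (_ , eq) = inj₁ eq
  ... | inj₂ (_ , transit≡1+k , _) = contradiction (trans (sym transit≡1+k) (proj₁ (quiet v p))) (λ ())

  quiescent-preserved : ∀ e c → Quiescent c → Quiescent (step e c)
  quiescent-preserved e c quiet with quiescent-step e c quiet
  ... | inj₁ eq       = subst Quiescent (sym eq) quiet
  ... | inj₂ (_ , eq) = subst Quiescent (sym eq) quiet

  pending : Config n → Fin n → Port → ℕ
  pending c w q = transit c w q + queue c w q

  private
    Idle : Config n → Fin n → Set
    Idle c w = pending c w false ≡ 0 × pending c w true ≡ 0

    idle? : ∀ c w → Dec (Idle c w)
    idle? c w = (pending c w false ≟ 0) ×-dec (pending c w true ≟ 0)

    idle-at : ∀ c {w} q → Idle c w → pending c w q ≡ 0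
    idle-at c false = proj₁
    idle-at c true  = proj₂

  quiescent-or-pending : ∀ c → Quiescent c ⊎ ∃[ w ] ∃[ q ] pending c w q ≢ 0
  quiescent-or-pending c with all? (idle? c)
  ... | yes allIdle = inj₁ λ w q → m+n≡0⇒m≡0 _ (idle-at c q (allIdle w)) , m+n≡0⇒n≡0 _ (idle-at c q (allIdle w))
  ... | no  ¬allIdle with ¬∀⟶∃¬ n (Idle c) (idle? c) ¬allIdle
  ...   | w , ¬idle with pending c w false ≟ 0
  ...     | yes idle₀ = inj₂ (w , true , λ idle₁ → ¬idle (idle₀ , idle₁))
  ...     | no  busy  = inj₂ (w , false , busy)

  transit-send-at : ∀ c w q → transit (send (destNode w q) (destPort w q) c) w q ≡ suc (transit c w q)
  transit-send-at c w q =
    subst₂ (λ w′ q′ → transit (send v p c) w′ q′ ≡ suc (transit c w′ q′))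
           (proj₁ (dest-involutive w q)) (proj₂ (dest-involutive w q)) (transit-send-same v p c)
    where
    v = destNode w q
    p = destPort w q

  transit-send-away : ∀ v p c w q → ¬ (destNode w q ≡ v × destPort w q ≡ p) → transit (send v p c) w q ≡ transit c w q
  transit-send-away v p c w q away = transit-send-other v p c w q (away ∘ λ (w≡ , q≡) → linked (sym w≡) (sym q≡))

  δ : Fin n → Fin n → ℕ
  δ v s = if does (v ≟ᶠ s) then 1 else 0

  sum-δ : ∀ s → sum (λ v → δ v s) ≡ 1
  sum-δ s = begin
    sum (λ v → δ v s)     ≡⟨ sum-update {f = λ _ → 0} s 1 (λ v v≢s → cong (λ b → if b then 1 else 0) (dec-false (v ≟ᶠ s) v≢s))
                                                          (cong (λ b → if b then 1 else 0) (dec-true (s ≟ᶠ s) refl)) ⟩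
    sum {n} (λ _ → 0) + 1 ≡⟨ cong (_+ 1) (trans (sum-const {n} 0) (*-zeroʳ n)) ⟩
    1                     ∎
    where open ≡-Reasoning

  blank : Config n
  blank = mkConfig (λ _ → mkNode (λ _ → 0) undecided nothing) (λ _ _ → 0) (λ _ _ → 0) 0

  sendBoth : Fin n → Config n → Config n
  sendBoth v c = send v true (send v false c)

  transit-sendBoth : ∀ v c w q → transit (sendBoth v c) w q ≡ δ v (destNode w q) + transit c w q
  transit-sendBoth v c w q with destNode w q ≟ᶠ v
  ... | no  w′≢v rewrite dec-false (v ≟ᶠ destNode w q) (w′≢v ∘ sym) =
    trans (transit-send-away v true (send v false c) w q (w′≢v ∘ proj₁)) (transit-send-away v false c w q (w′≢v ∘ proj₁))
  ... | yes refl rewrite dec-true (v ≟ᶠ v) refl with destPort w q in q′≡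
  ...   | false = trans (transit-send-away v true (send v false c) w q (λ (_ , q′≡true) → contradiction (trans (sym q′≡) q′≡true) λ ()))
                        (subst (λ p → transit (send v p c) w q ≡ suc (transit c w q)) q′≡ (transit-send-at c w q))
  ...   | true  = trans (subst (λ p → transit (send v p (send v false c)) w q ≡ suc (transit (send v false c) w q)) q′≡ (transit-send-at (send v false c) w q))
                        (cong suc (transit-send-away v false c w q (λ (_ , q′≡false) → contradiction (trans (sym q′≡) q′≡false) λ ())))

  initial-node : ∀ xs → node (foldr sendBoth blank xs) ≡ node blank
  initial-node []       = refl
  initial-node (_ ∷ xs) = initial-node xs

  initial-queue : ∀ xs → queue (foldr sendBoth blank xs) ≡ queue blank
  initial-queue []       = refl
  initial-queue (_ ∷ xs) = initial-queue xs

  initial-sent : ∀ {k} (g : Fin k → Fin n) → sent (foldr sendBoth blank (tabulate g)) ≡ k * 2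
  initial-sent {zero}  g = refl
  initial-sent {suc k} g = cong (2 +_) (initial-sent (g ∘ suc))

  initial-transit : ∀ {k} (g : Fin k → Fin n) w q → transit (foldr sendBoth blank (tabulate g)) w q ≡ sum (λ i → δ (g i) (destNode w q))
  initial-transit {zero}  g w q = refl
  initial-transit {suc k} g w q = trans (transit-sendBoth (g zero) (foldr sendBoth blank (tabulate (g ∘ suc))) w q) (cong (δ (g zero) (destNode w q) +_) (initial-transit (g ∘ suc) w q))

  decideState-cw : ∀ id s → IDp id true ≤ ρ s false ⊔ ρ s true → ρ s true < ρ s false →
                   cw (decideState id s) ≡ just true
  decideState-cw id s decided ρ₁<ρ₀
    rewrite dec-true (IDp id true ≤? ρ s false ⊔ ρ s true) decided
          | dec-true (suc (ρ s true) ≤? ρ s false) ρ₁<ρ₀ = refl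

  decideState-ccw : ∀ id s → IDp id true ≤ ρ s false ⊔ ρ s true → ρ s false ≤ ρ s true →
                    cw (decideState id s) ≡ just false
  decideState-ccw id s decided ρ₀≤ρ₁
    rewrite dec-true (IDp id true ≤? ρ s false ⊔ ρ s true) decided
          | dec-false (suc (ρ s true) ≤? ρ s false) (≤⇒≯ ρ₀≤ρ₁) = refl

  decideState-leader : ∀ id s → ρ s false ≡ IDp id true → ρ s true < IDp id true →
                       status (decideState id s) ≡ leader
  decideState-leader id s ρ₀≡ ρ₁<
    rewrite dec-true (IDp id true ≤? ρ s false ⊔ ρ s true) (≤-trans (≤-reflexive (sym ρ₀≡)) (m≤m⊔n _ _))
          | dec-true (ρ s false ≟ IDp id true) ρ₀≡
          | dec-true (suc (ρ s true) ≤? IDp id true) ρ₁< = refl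

  decideState-nonLeader : ∀ id s → IDp id true ≤ ρ s false ⊔ ρ s true → ρ s false ≢ IDp id true →
                          status (decideState id s) ≡ nonLeader
  decideState-nonLeader id s decided ρ₀≢
    rewrite dec-true (IDp id true ≤? ρ s false ⊔ ρ s true) decided
          | dec-false (ρ s false ≟ IDp id true) ρ₀≢ = refl

  -- Directions around the ring

  data Direction : Set where
    clockwise counterclockwise : Direction

  reverse : Direction → Direction
  reverse clockwise        = counterclockwise
  reverse counterclockwise = clockwise

  neighbour : Direction → Fin n → Fin n
  neighbour clockwise        = next n
  neighbour counterclockwise = prev n

  facing : Direction → Fin n → Port
  facing clockwise        v = o v
  facing counterclockwise v = not (o v)

  direction : Fin n → Port → Direction
  direction v p = if does (p ≟ᵇ o v) then clockwise else counterclockwise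

  facing-reverse : ∀ D v → facing (reverse D) v ≡ not (facing D v)
  facing-reverse clockwise        v = refl
  facing-reverse counterclockwise v = sym (not-involutive (o v))

  direction-facing : ∀ D v → direction v (facing D v) ≡ D
  direction-facing clockwise        v rewrite dec-true  (o v ≟ᵇ o v) refl = refl
  direction-facing counterclockwise v rewrite dec-false (not (o v) ≟ᵇ o v) not≢self = refl

  facing-direction : ∀ v p → facing (direction v p) v ≡ p
  facing-direction v p with p ≟ᵇ o v
  ... | yes refl = refl
  ... | no  p≢ov = sym (¬-not p≢ov)

  direction-not : ∀ v p → direction v (not p) ≡ reverse (direction v p)
  direction-not v p with p ≟ᵇ o v
  ... | yes refl rewrite dec-false (not (o v) ≟ᵇ o v) not≢self = refl
  ... | no  p≢ov rewrite ¬-not p≢ov | not-involutive (o v) | dec-true (o v ≟ᵇ o v) refl = refl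

  -- pulses received at the port opposite to p travel in the direction p faces
  direction-incoming : ∀ v p → direction (destNode v (not p)) (destPort v (not p)) ≡ direction v p
  direction-incoming v p with p ≟ᵇ o v
  ... | yes refl
    rewrite dec-false (not (o v) ≟ᵇ o v) not≢self
          | dec-true (o (prev n v) ≟ᵇ o (prev n v)) refl = refl
  ... | no  p≢ov
    rewrite ¬-not p≢ov | not-involutive (o v)
          | dec-true (o v ≟ᵇ o v) refl
          | dec-false (not (o (next n v)) ≟ᵇ o (next n v)) not≢self = refl

  dest-facing : ∀ D v → destNode v (facing D v) ≡ neighbour D v
                      × destPort v (facing D v) ≡ not (facing D (neighbour D v))
  dest-facing clockwise        v rewrite dec-true  (o v ≟ᵇ o v) refl = refl , refl
  dest-facing counterclockwise v rewrite dec-false (not (o v) ≟ᵇ o v) not≢self =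
    refl , sym (not-involutive _)

  neighbour-cyclic : ∀ D → Cyclic (neighbour D)
  neighbour-cyclic clockwise        = next-cyclic n
  neighbour-cyclic counterclockwise = prev-cyclic n

  walk-facing : ∀ D u m → walk (facing D) u m ≡ fold u (neighbour D) m
  walk-facing D u zero    = refl
  walk-facing D u (suc m) = trans (proj₁ (dest-facing D _)) (cong (neighbour D) (walk-facing D u m))

  edgeAt-clockwise : ∀ u m → edgeAt (facing clockwise) u m ≡ walk (facing clockwise) u m
  edgeAt-clockwise u m = along (walk (facing clockwise) u m)
    where
    along : ∀ w → (if does (o w ≟ᵇ o w) then w else prev n w) ≡ w
    along w rewrite dec-true (o w ≟ᵇ o w) refl = refl

  edgeAt-counterclockwise : ∀ u m → edgeAt (facing counterclockwise) u m ≡ prev n (walk (facing counterclockwise) u m)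
  edgeAt-counterclockwise u m = against (walk (facing counterclockwise) u m)
    where
    against : ∀ w → (if does (not (o w) ≟ᵇ o w) then w else prev n w) ≡ prev n w
    against w rewrite dec-false (not (o w) ≟ᵇ o w) not≢self = refl

  facing-consistent : ∀ D → ConsistentOrientation (facing D)
  facing-consistent clockwise u e with next-cyclic n u e
  ... | m , reaches = m , trans (edgeAt-clockwise u m) (trans (walk-facing clockwise u m) reaches)
  facing-consistent counterclockwise u e with prev-cyclic n (prev n u) e
  ... | m , reaches = m , (begin
    edgeAt (facing counterclockwise) u m           ≡⟨ edgeAt-counterclockwise u m ⟩
    prev n (walk (facing counterclockwise) u m)    ≡⟨ cong (prev n) (walk-facing counterclockwise u m) ⟩
    fold u (prev n) (suc m)                        ≡⟨ fold-suc u (prev n) m ⟩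
    fold (prev n u) (prev n) m                     ≡⟨ reaches ⟩
    e                                              ∎)
    where open ≡-Reasoning

IDmax-tabulate : ∀ k (f : Fin k → ℕ) → IDmax k f ≡ foldr _⊔_ 0 (tabulate f)
IDmax-tabulate k f = cong (foldr _⊔_ 0) (map-tabulate id f)

IDmax-upper : ∀ k (f : Fin k → ℕ) v → f v ≤ IDmax k f
IDmax-upper k f v rewrite IDmax-tabulate k f = bound f v
  where
  bound : ∀ {k} (f : Fin k → ℕ) v → f v ≤ foldr _⊔_ 0 (tabulate f)
  bound f zero    = m≤m⊔n _ _
  bound f (suc v) = ≤-trans (bound (f ∘ suc) v) (m≤n⊔m _ _)

IDmax-attained : ∀ k .{{_ : NonZero k}} (f : Fin k → ℕ) → ∃[ v ] f v ≡ IDmax k f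
IDmax-attained k f rewrite IDmax-tabulate k f = attained k f
  where
  attained : ∀ k .{{_ : NonZero k}} (f : Fin k → ℕ) → ∃[ v ] f v ≡ foldr _⊔_ 0 (tabulate f)
  attained (suc zero)    f = zero , sym (⊔-identityʳ (f zero))
  attained (suc (suc k)) f with attained (suc k) (f ∘ suc) | ⊔-sel (f zero) (foldr _⊔_ 0 (tabulate (f ∘ suc)))
  ... | _ , _     | inj₁ left  = zero , sym left
  ... | v , reach | inj₂ right = suc v , trans reach (sym right)

-- Correctness

module Correctness (n : ℕ) .{{_ : NonZero n}} (o : Fin n → Port) (ID : Fin n → ℕ)
                   (ID-positive : ∀ v → 0 < ID v) (ID-injective : Injective _≡_ _≡_ ID) where

  open Alg n o ID
  open Execution n o ID

  M : ℕ
  M = IDmax n ID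

  ℓ : Fin n
  ℓ = proj₁ (IDmax-attained n ID)

  IDℓ≡M : ID ℓ ≡ M
  IDℓ≡M = proj₂ (IDmax-attained n ID)

  M-positive : 0 < M
  M-positive = subst (0 <_) IDℓ≡M (ID-positive ℓ)

  ID<M : ∀ v → v ≢ ℓ → ID v < M
  ID<M v v≢ℓ = ≤∧≢⇒< (IDmax-upper n ID v) (v≢ℓ ∘ ID-injective ∘ λ IDv≡M → trans IDv≡M (sym IDℓ≡M))

  -- Every pulse travelling in some direction is eventually absorbed at ℓ,
  -- whose threshold for that direction is the largest.
  finalCount : Fin n → Port → ℕ
  finalCount v p = IDp M (facing (direction v p) ℓ)

  finalCount-facing : ∀ D v → finalCount v (facing D v) ≡ IDp M (facing D ℓ)
  finalCount-facing D v = cong (λ D′ → IDp M (facing D′ ℓ)) (direction-facing D v)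

  threshold≤finalCount : ∀ v p → IDp (ID v) p ≤ finalCount v p
  threshold≤finalCount v p with v ≟ᶠ ℓ
  ... | no  v≢ℓ  = <⇒≤ (IDp-mono-< p _ (ID-positive v) (ID<M v v≢ℓ))
  ... | yes refl = ≤-reflexive (cong₂ IDp IDℓ≡M (sym (facing-direction ℓ p)))

  -- The invariant

  emittedBy : Config n → Fin n → Port → ℕ
  emittedBy c v p = emitted (consumed c v (not p)) (IDp (ID v) p)

  incoming : Config n → Fin n → Port → ℕ
  incoming c w q = transit c w q + delivered c w q

  record Invariant (c : Config n) : Set where
    field
      conservation : ∀ w q → incoming c w q ≡ emittedBy c (destNode w q) (destPort w q)
      bounded      : ∀ v p → emittedBy c v p ≤ finalCount v p
      sent-total   : sent c ≡ sum² (emittedBy c)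
  open Invariant

  invariant-unchanged : ∀ {c c'} → Invariant c →
    (∀ w q → incoming c' w q ≡ incoming c w q) → (∀ v p → emittedBy c' v p ≡ emittedBy c v p) →
    sent c' ≡ sent c → Invariant c'
  invariant-unchanged inv same-incoming same-emitted same-sent = record
    { conservation = λ w q → trans (same-incoming w q) (trans (conservation inv w q) (sym (same-emitted _ _)))
    ; bounded      = λ v p → subst (_≤ finalCount v p) (sym (same-emitted v p)) (bounded inv v p)
    ; sent-total   = trans same-sent (trans (sent-total inv) (sum²-cong (λ v p → sym (same-emitted v p)))) }

  invariant-emit : ∀ {c c'} v i a → Invariant c →
    incoming c' (destNode v i) (destPort v i) ≡ incoming c (destNode v i) (destPort v i) + a →
    (∀ w q → ¬ (w ≡ destNode v i × q ≡ destPort v i) → incoming c' w q ≡ incoming c w q) →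
    emittedBy c' v i ≡ emittedBy c v i + a →
    (∀ u p → ¬ (u ≡ v × p ≡ i) → emittedBy c' u p ≡ emittedBy c u p) →
    sent c' ≡ sent c + a →
    emittedBy c' v i ≤ finalCount v i →
    Invariant c'
  invariant-emit {c} {c'} v i a inv at-dest elsewhere emits-a others sends-a within = record
    { conservation = conserved
    ; bounded      = bound
    ; sent-total   = trans sends-a (trans (cong (_+ a) (sent-total inv)) (sym (sum²-update v i a others emits-a))) }
    where
    conserved : ∀ w q → incoming c' w q ≡ emittedBy c' (destNode w q) (destPort w q)
    conserved w q with (w ≟ᶠ destNode v i) ×-dec (q ≟ᵇ destPort v i)
    ... | yes (refl , refl) = begin
      incoming c' (destNode v i) (destPort v i)     ≡⟨ at-dest ⟩
      incoming c (destNode v i) (destPort v i) + a  ≡⟨ cong (_+ a) (conservation inv _ _) ⟩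
      emittedBy c v′ i′ + a                         ≡⟨ cong₂ (λ u p → emittedBy c u p + a) v′≡ i′≡ ⟩
      emittedBy c v i + a                           ≡⟨ emits-a ⟨
      emittedBy c' v i                              ≡⟨ cong₂ (emittedBy c') v′≡ i′≡ ⟨
      emittedBy c' v′ i′                            ∎
      where
      open ≡-Reasoning
      v′ = destNode (destNode v i) (destPort v i)
      i′ = destPort (destNode v i) (destPort v i)
      v′≡ = proj₁ (dest-involutive v i)
      i′≡ = proj₂ (dest-involutive v i)
    ... | no  ¬dest = trans (elsewhere w q ¬dest) (trans (conservation inv w q) (sym (others _ _ not-source)))
      where
      not-source : ¬ (destNode w q ≡ v × destPort w q ≡ i)
      not-source (w′≡v , q′≡i) = let v′≡w , i′≡q = linked w′≡v q′≡i in ¬dest (sym v′≡w , sym i′≡q)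
    bound : ∀ u p → emittedBy c' u p ≤ finalCount u p
    bound u p with (u ≟ᶠ v) ×-dec (p ≟ᵇ i)
    ... | yes (refl , refl) = within
    ... | no  ¬vi           = subst (_≤ finalCount u p) (sym (others u p ¬vi)) (bounded inv u p)

  module _ (v : Fin n) (i : Port) (k : ℕ) (c : Config n) (queued : queue c v (not i) ≡ suc k) where

    private
      c₁ = consumeOne v (not i) k c
      r  = consumed c v (not i)
      a  = IDp (ID v) i

    emittedBy-consumeOne : emittedBy c₁ v i ≡ emitted (suc r) a
    emittedBy-consumeOne = cong (λ x → emitted x a) (consumed-consumeOne-same v (not i) k c)

    emittedBy-consumeOne-other : ∀ u p → ¬ (u ≡ v × p ≡ i) → emittedBy c₁ u p ≡ emittedBy c u p
    emittedBy-consumeOne-other u p ¬vi =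
      cong (λ x → emitted x (IDp (ID u) p))
           (consumed-consumeOne-other v (not i) k c u (not p) λ (u≡v , ¬p≡¬i) → ¬vi (u≡v , not-injective ¬p≡¬i))

    incoming-consumeOne : ∀ w q → incoming c₁ w q ≡ incoming c w q
    incoming-consumeOne w q = cong (transit c w q +_) (delivered-consumeOne v (not i) k c queued w q)

    -- the consumed pulse was emitted by the upstream neighbour, in the same direction
    emittedBy-consumeOne-bounded : Invariant c → emittedBy c₁ v i ≤ finalCount v i
    emittedBy-consumeOne-bounded inv = subst (_≤ finalCount v i) (sym emittedBy-consumeOne)
      (emitted-lub (begin
        suc r                                                   ≤⟨ s≤s (m≤n+m r k) ⟩
        suc k + r                                               ≡⟨ cong (_+ r) queued ⟨
        delivered c v (not i)                                   ≤⟨ m≤n+m _ (transit c v (not i)) ⟩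
        incoming c v (not i)                                    ≡⟨ conservation inv v (not i) ⟩
        emittedBy c (destNode v (not i)) (destPort v (not i))   ≤⟨ bounded inv _ _ ⟩
        finalCount (destNode v (not i)) (destPort v (not i))    ≡⟨ cong (λ D → IDp M (facing D ℓ)) (direction-incoming v i) ⟩
        finalCount v i                                          ∎)
      (threshold≤finalCount v i))
      where open ≤-Reasoning

    invariant-absorb : Invariant c → suc r ≡ a → Invariant c₁
    invariant-absorb inv absorbed = invariant-unchanged inv incoming-consumeOne unchanged refl
      where
      unchanged : ∀ u p → emittedBy c₁ u p ≡ emittedBy c u p
      unchanged u p with (u ≟ᶠ v) ×-dec (p ≟ᵇ i)
      ... | yes (refl , refl) = trans emittedBy-consumeOne (emitted-suc-threshold absorbed)
      ... | no  ¬vi           = emittedBy-consumeOne-other u p ¬vi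

    invariant-forward : Invariant c → suc r ≢ a → Invariant (send v i c₁)
    invariant-forward inv forwarded = invariant-emit v i 1 inv
      (trans (cong (_+ delivered c₁ (destNode v i) (destPort v i)) (transit-send-same v i c₁))
             (trans (cong suc (incoming-consumeOne _ _)) (+-comm 1 _)))
      (λ w q ¬dest → trans (cong (_+ delivered c₁ w q) (transit-send-other v i c₁ w q ¬dest)) (incoming-consumeOne w q))
      (trans emittedBy-consumeOne (trans (emitted-suc forwarded) (+-comm 1 _)))
      emittedBy-consumeOne-other
      (+-comm 1 _)
      (emittedBy-consumeOne-bounded inv)

  invariant-bodyI : ∀ v i c → Invariant c → Invariant (bodyI v i c)
  invariant-bodyI v i c inv with bodyI-cases v i c
  ... | inj₁ (_ , eq)                               rewrite eq = inv
  ... | inj₂ (k , queued , inj₁ (absorbed , eq))    rewrite eq = invariant-absorb v i k c queued inv absorbed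
  ... | inj₂ (k , queued , inj₂ (forwarded , eq))   rewrite eq = invariant-forward v i k c queued inv forwarded

  invariant-decide : ∀ v c → Invariant c → Invariant (decide v c)
  invariant-decide v c inv = invariant-unchanged inv
    (λ w q → cong (λ x → transit c w q + (queue c w q + x)) (consumed-decide v c w q))
    (λ u p → cong (λ x → emitted x (IDp (ID u) p)) (consumed-decide v c u (not p)))
    refl

  invariant-deliverOne : ∀ v p k c → transit c v p ≡ suc k → Invariant c → Invariant (deliverOne v p k c)
  invariant-deliverOne v p k c in-transit inv = invariant-unchanged inv same-incoming (λ _ _ → refl) refl
    where
    same-incoming : ∀ w q → incoming (deliverOne v p k c) w q ≡ incoming c w q
    same-incoming w q with (w ≟ᶠ v) ×-dec (q ≟ᵇ p)
    ... | yes (refl , refl)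
      rewrite upd-same (transit c) v p (λ _ → k) | upd-same (queue c) v p suc | in-transit = +-suc k _
    ... | no  ¬vp
      rewrite upd-other (transit c) v p (λ _ → k) w q ¬vp | upd-other (queue c) v p suc w q ¬vp = refl

  invariant-step : ∀ e c → Invariant c → Invariant (step e c)
  invariant-step (act v) c inv = invariant-decide v _ (invariant-bodyI v true _ (invariant-bodyI v false c inv))
  invariant-step (deliver v p) c inv with deliver-cases v p c
  ... | inj₁ (_ , eq)              rewrite eq = inv
  ... | inj₂ (k , in-transit , eq) rewrite eq = invariant-deliverOne v p k c in-transit inv

  invariant-initial : Invariant initConfig
  invariant-initial = record
    { conservation = λ w q → begin
        incoming initConfig w q          ≡⟨ cong₂ _+_ (trans (initial-transit id w q) (sum-δ _)) (cong₂ _+_ (cong (λ f → f w q) (initial-queue (allFin n))) (cong (λ f → ρ (f w) q) (initial-node (allFin n)))) ⟩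
        1                                ≡⟨ emits-one _ _ ⟨
        emittedBy initConfig _ _         ∎
    ; bounded      = λ v p → subst (_≤ finalCount v p) (sym (emits-one v p)) (≤-trans (IDp-positive p (ID-positive v)) (threshold≤finalCount v p))
    ; sent-total   = begin
        sent initConfig                  ≡⟨ initial-sent id ⟩
        n * 2                            ≡⟨ sum-const {n} 2 ⟨
        sum {n} (λ _ → 2)                ≡⟨ sum²-cong (λ v p → sym (emits-one v p)) ⟩
        sum² (emittedBy initConfig)      ∎ }
    where
    open ≡-Reasoning
    emits-one : ∀ v p → emittedBy initConfig v p ≡ 1
    emits-one v p = trans (cong (λ f → emitted (ρ (f v) (not p)) (IDp (ID v) p)) (initial-node (allFin n)))
                          (emitted-zero (IDp-positive p (ID-positive v)))

  invariant-run : ∀ sch t → Invariant (run sch t)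
  invariant-run sch zero    = invariant-initial
  invariant-run sch (suc t) = invariant-step (sch t) _ (invariant-run sch t)

  -- Quiescent configurations

  module _ {c : Config n} (inv : Invariant c) (quiet : Quiescent c) where

    consumed-quiescent : ∀ w q → consumed c w q ≡ emittedBy c (destNode w q) (destPort w q)
    consumed-quiescent w q = begin
      consumed c w q                  ≡⟨⟩
      0 + (0 + consumed c w q)        ≡⟨ cong₂ (λ x y → x + (y + consumed c w q)) (proj₁ (quiet w q)) (proj₂ (quiet w q)) ⟨
      incoming c w q                  ≡⟨ conservation inv w q ⟩
      emittedBy c (destNode w q) (destPort w q) ∎
      where open ≡-Reasoning

    consumed-final : ∀ D w → consumed c w (not (facing D w)) ≡ IDp M (facing D ℓ)
    consumed-final D w = ≤-antisym upper lower
      where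
      open ≤-Reasoning
      received : Fin n → ℕ
      received v = consumed c v (not (facing D v))
      forwarded : ∀ v → received (neighbour D v) ≡ emittedBy c v (facing D v)
      forwarded v = begin-equality
        received (neighbour D v)                       ≡⟨ cong₂ (consumed c) (proj₁ (dest-facing D v)) (proj₂ (dest-facing D v)) ⟨
        consumed c (destNode v (facing D v)) (destPort v (facing D v))
          ≡⟨ consumed-quiescent _ _ ⟩
        emittedBy c (destNode (destNode v (facing D v)) (destPort v (facing D v)))
                    (destPort (destNode v (facing D v)) (destPort v (facing D v)))
          ≡⟨ cong₂ (emittedBy c) (proj₁ (dest-involutive v (facing D v))) (proj₂ (dest-involutive v (facing D v))) ⟩
        emittedBy c v (facing D v)                     ∎
      constant : ∀ u v → received u ≡ received v
      constant = cyclic-mono⇒const (neighbour-cyclic D) received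
        (λ v → subst (received v ≤_) (sym (forwarded v)) (c≤emitted _ _))
      upper : received w ≤ IDp M (facing D ℓ)
      upper = begin
        received w                  ≡⟨ constant w (neighbour D ℓ) ⟩
        received (neighbour D ℓ)    ≡⟨ forwarded ℓ ⟩
        emittedBy c ℓ (facing D ℓ)  ≤⟨ bounded inv ℓ (facing D ℓ) ⟩
        finalCount ℓ (facing D ℓ)   ≡⟨ finalCount-facing D ℓ ⟩
        IDp M (facing D ℓ)          ∎
      lower : IDp M (facing D ℓ) ≤ received w
      lower = begin
        IDp M (facing D ℓ)          ≡⟨ cong (λ x → IDp x (facing D ℓ)) IDℓ≡M ⟨
        IDp (ID ℓ) (facing D ℓ)     ≤⟨ emitted-saturated⁻¹ (trans (sym (forwarded ℓ)) (constant (neighbour D ℓ) ℓ)) ⟩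
        received ℓ                  ≡⟨ constant ℓ w ⟩
        received w                  ∎

    emittedBy-final : ∀ v p → emittedBy c v p ≡ finalCount v p
    emittedBy-final v p = begin
      emitted (consumed c v (not p)) (IDp (ID v) p)
        ≡⟨ cong (λ x → emitted (consumed c v (not x)) (IDp (ID v) p)) (facing-direction v p) ⟨
      emitted (consumed c v (not (facing D v))) (IDp (ID v) p)
        ≡⟨ cong (λ x → emitted x (IDp (ID v) p)) (consumed-final D v) ⟩
      emitted (finalCount v p) (IDp (ID v) p)
        ≡⟨ emitted-saturated (threshold≤finalCount v p) ⟩
      finalCount v p ∎
      where
      open ≡-Reasoning
      D = direction v p

    sent-final : sent c ≡ n * (4 * M ∸ 1)
    sent-final = begin
      sent c                         ≡⟨ sent-total inv ⟩
      sum² (emittedBy c)             ≡⟨ sum²-cong emittedBy-final ⟩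
      sum² finalCount                ≡⟨ sum-cong-≗ pair ⟩
      sum {n} (λ _ → 4 * M ∸ 1)      ≡⟨ sum-const {n} (4 * M ∸ 1) ⟩
      n * (4 * M ∸ 1)                ∎
      where
      open ≡-Reasoning
      pair : ∀ v → finalCount v false + finalCount v true ≡ 4 * M ∸ 1
      pair v = begin
        IDp M (facing D ℓ) + IDp M (facing (direction v true) ℓ)
          ≡⟨ cong (λ D′ → IDp M (facing D ℓ) + IDp M (facing D′ ℓ)) (direction-not v false) ⟩
        IDp M (facing D ℓ) + IDp M (facing (reverse D) ℓ)
          ≡⟨ cong (λ x → IDp M (facing D ℓ) + IDp M x) (facing-reverse D ℓ) ⟩
        IDp M (facing D ℓ) + IDp M (not (facing D ℓ))
          ≡⟨ IDp-pair (facing D ℓ) M-positive ⟩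
        4 * M ∸ 1 ∎
        where D = direction v false

  -- nodes declare as clockwise the direction in which ℓ forwards on Port 1
  orientation : Direction
  orientation = if o ℓ then clockwise else counterclockwise

  facing-orientation : facing orientation ℓ ≡ true
  facing-orientation with o ℓ in oℓ≡
  ... | true  = oℓ≡
  ... | false = cong not oℓ≡

  Settled : Config n → Fin n → Set
  Settled c v = cw (node c v) ≡ just (facing orientation v)
              × (v ≡ ℓ → status (node c v) ≡ leader)
              × (v ≢ ℓ → status (node c v) ≡ nonLeader)

  module _ {c : Config n} (inv : Invariant c) (quiet : Quiescent c) (v : Fin n) where

    private
      p = facing orientation v
      s = node c v

    received-ahead : ρ s (not p) ≡ IDp M true
    received-ahead = trans (consumed-final inv quiet orientation v) (cong (IDp M) facing-orientation)

    received-behind : ρ s p ≡ IDp M false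
    received-behind = begin
      ρ s p                                               ≡⟨ cong (ρ s) (not-involutive p) ⟨
      ρ s (not (not p))                                   ≡⟨ cong (ρ s ∘ not) (facing-reverse orientation v) ⟨
      ρ s (not (facing (reverse orientation) v))          ≡⟨ consumed-final inv quiet (reverse orientation) v ⟩
      IDp M (facing (reverse orientation) ℓ)              ≡⟨ cong (IDp M) (trans (facing-reverse orientation ℓ) (cong not facing-orientation)) ⟩
      IDp M false                                         ∎
      where open ≡-Reasoning

    decided : IDp (ID v) true ≤ ρ s false ⊔ ρ s true
    decided = ≤-trans (IDp-mono-≤ true (IDmax-upper n ID v)) (reaches p received-ahead)
      where
      reaches : ∀ p → ρ s (not p) ≡ IDp M true → IDp M true ≤ ρ s false ⊔ ρ s true
      reaches false eq = ≤-trans (≤-reflexive (sym eq)) (m≤n⊔m _ _)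
      reaches true  eq = ≤-trans (≤-reflexive (sym eq)) (m≤m⊔n _ _)

    settles : Settled (decide v c) v
    settles rewrite updNode-same (node c) v (decideState (ID v) s) =
      declared p received-ahead received-behind , elected , defeated
      where
      declared : ∀ p → ρ s (not p) ≡ IDp M true → ρ s p ≡ IDp M false → cw (decideState (ID v) s) ≡ just p
      declared false ahead behind = decideState-ccw (ID v) s decided
        (≤-trans (≤-reflexive behind) (≤-trans (IDp≤IDp-true false M-positive) (≤-reflexive (sym ahead))))
      declared true  ahead behind = decideState-cw (ID v) s decided
        (subst₂ _<_ (sym behind) (sym ahead) (IDp-false<true M-positive))

      elected : v ≡ ℓ → status (decideState (ID v) s) ≡ leader
      elected v≡ℓ = decideState-leader (ID v) s
        (trans (cong (ρ s ∘ not) (sym p≡true)) (trans received-ahead IDpM≡))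
        (subst₂ _<_ (trans (sym received-behind) (cong (ρ s) p≡true)) IDpM≡ (IDp-false<true M-positive))
        where
        p≡true : p ≡ true
        p≡true = trans (cong (facing orientation) v≡ℓ) facing-orientation
        IDpM≡ : IDp M true ≡ IDp (ID v) true
        IDpM≡ = cong (λ x → IDp x true) (sym (trans (cong ID v≡ℓ) IDℓ≡M))

      defeated : v ≢ ℓ → status (decideState (ID v) s) ≡ nonLeader
      defeated v≢ℓ = decideState-nonLeader (ID v) s decided λ ρ₀≡ →
        let x , ρ₀≡M = port0-final p received-ahead received-behind in
        <⇒≢ (IDp-mono-< true x (ID-positive v) (ID<M v v≢ℓ)) (trans (sym ρ₀≡) ρ₀≡M)
        where
        port0-final : ∀ p → ρ s (not p) ≡ IDp M true → ρ s p ≡ IDp M false → ∃[ x ] ρ s false ≡ IDp M x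
        port0-final false _     behind = false , behind
        port0-final true  ahead _      = true , ahead

  settled-preserved : ∀ e {c} w → Invariant c → Quiescent c → Settled c w → Settled (step e c) w
  settled-preserved e {c} w inv quiet settled with quiescent-step e c quiet
  ... | inj₁ eq       = subst (λ c′ → Settled c′ w) (sym eq) settled
  ... | inj₂ (v , eq) = subst (λ c′ → Settled c′ w) (sym eq) (decided-at (w ≟ᶠ v))
    where
    decided-at : Dec (w ≡ v) → Settled (decide v c) w
    decided-at (yes refl) = settles inv quiet w
    decided-at (no  w≢v)  = subst (λ s → cw s ≡ just (facing orientation w) × (w ≡ ℓ → status s ≡ leader) × (w ≢ ℓ → status s ≡ nonLeader))
                                  (sym (updNode-other (node c) v _ w w≢v)) settled

  -- Through the conservation law, the counts determine the queues and the
  -- pulses in transit.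
  stalled : ∀ {c c'} → Invariant c → Invariant c' → c ⊑ c' → measure c ≡ measure c' →
    ∀ w q → transit c w q ≡ transit c' w q × queue c w q ≡ queue c' w q
  stalled {c} {c'} inv inv' c⊑c' eq w q = same-transit , same-queue
    where
    same-consumed = measure-≡⇒consumed-≡ c⊑c' eq
    same-delivered = measure-≡⇒delivered-≡ c⊑c' eq
    same-transit : transit c w q ≡ transit c' w q
    same-transit = +-cancelʳ-≡ (delivered c w q) _ _ (begin
      transit c w q + delivered c w q      ≡⟨ conservation inv w q ⟩
      emittedBy c (destNode w q) (destPort w q)  ≡⟨ cong (λ x → emitted x (IDp (ID (destNode w q)) (destPort w q))) (same-consumed _ _) ⟩
      emittedBy c' (destNode w q) (destPort w q) ≡⟨ conservation inv' w q ⟨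
      transit c' w q + delivered c' w q    ≡⟨ cong (transit c' w q +_) (same-delivered w q) ⟨
      transit c' w q + delivered c w q     ∎)
      where open ≡-Reasoning
    same-queue : queue c w q ≡ queue c' w q
    same-queue = +-cancelʳ-≡ (consumed c w q) _ _ (trans (same-delivered w q) (cong (queue c' w q +_) (sym (same-consumed w q))))

  measureBound : ℕ
  measureBound = sum² {n} (λ _ _ → IDp M true + IDp M true)

  measure-bounded : ∀ {c} → Invariant c → measure c ≤ measureBound
  measure-bounded {c} inv = sum²-mono-≤ λ w q → +-mono-≤ (delivered≤ w q) (≤-trans (m≤n+m _ (queue c w q)) (delivered≤ w q))
    where
    delivered≤ : ∀ w q → delivered c w q ≤ IDp M true
    delivered≤ w q = begin
      delivered c w q                            ≤⟨ m≤n+m _ (transit c w q) ⟩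
      incoming c w q                             ≡⟨ conservation inv w q ⟩
      emittedBy c (destNode w q) (destPort w q)  ≤⟨ bounded inv _ _ ⟩
      finalCount (destNode w q) (destPort w q)   ≤⟨ IDp≤IDp-true _ M-positive ⟩
      IDp M true                                 ∎
      where open ≤-Reasoning

  module Liveness (sch : ℕ → Event) (fair : Fair sch) where

    private
      cfg : ℕ → Config n
      cfg = run sch

    -- Either the measure has grown by the time e is scheduled, or nothing has
    -- changed, P still holds and e itself makes progress.
    progress-by : ∀ (e : Event) (P : Config n → Set) t →
      (∀ {c c'} → Invariant c → Invariant c' → c ⊑ c' → measure c ≡ measure c' → P c → P c') →
      (∀ c → P c → measure c < measure (step e c)) →
      P (cfg t) → ∃[ t' ] t ≤ t' × measure (cfg t) < measure (cfg t')
    progress-by e P t survives productive Pt with fair e t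
    ... | t' , t≤t' , scheduled with m≤n⇒m<n∨m≡n (measure-mono (⊑-run sch t≤t'))
    ...   | inj₁ grew = t' , t≤t' , grew
    ...   | inj₂ same = suc t' , m≤n⇒m≤1+n t≤t' , ≤-<-trans (≤-reflexive same)
      (subst (λ e′ → measure (cfg t') < measure (step e′ (cfg t'))) (sym scheduled)
             (productive (cfg t') (survives (invariant-run sch t) (invariant-run sch t') (⊑-run sch t≤t') same Pt)))

    progress : ∀ t w q → pending (cfg t) w q ≢ 0 → ∃[ t' ] t ≤ t' × measure (cfg t) < measure (cfg t')
    progress t w q busy with transit (cfg t) w q ≟ 0
    ... | no  in-transit = progress-by (deliver w q) (λ c → transit c w q ≢ 0) t
      (λ inv inv' c⊑c' eq ≢0 → ≢0 ∘ trans (proj₁ (stalled inv inv' c⊑c' eq w q)))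
      (λ c ≢0 → measure-mono-<-delivered (⊑-step (deliver w q) c) w q (delivered-deliver c w q ≢0))
      in-transit
    ... | yes none = progress-by (act w) (λ c → queue c w q ≢ 0) t
      (λ inv inv' c⊑c' eq ≢0 → ≢0 ∘ trans (proj₂ (stalled inv inv' c⊑c' eq w q)))
      (λ c ≢0 → measure-mono-<-consumed (⊑-step (act w) c) w q (consumed-act c w q ≢0))
      (λ queue≡0 → busy (cong₂ _+_ none queue≡0))

    quiescent-within : ∀ fuel t → measureBound ∸ measure (cfg t) ≤ fuel →
      ∃[ t' ] t ≤ t' × Quiescent (cfg t')
    quiescent-within fuel t budget with quiescent-or-pending (cfg t)
    ... | inj₁ quiet = t , ≤-refl , quiet
    ... | inj₂ (w , q , busy) with progress t w q busy
    ...   | t' , t≤t' , grew with fuel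
    ...     | zero     = contradiction (≤-trans (∸-monoʳ-< grew (measure-bounded (invariant-run sch t'))) budget) λ ()
    ...     | suc fuel′ with quiescent-within fuel′ t' (≤-pred (≤-trans (∸-monoʳ-< grew (measure-bounded (invariant-run sch t'))) budget))
    ...       | t'' , t'≤t'' , quiet = t'' , ≤-trans t≤t' t'≤t'' , quiet

    stabilises : ∃[ T ] ∀ t → T ≤ t →
      Quiescent (cfg t) × UniqueLeader (cfg t) × OrientedRing (cfg t) × sent (cfg t) ≡ n * (4 * M ∸ 1)
    stabilises = horizon , outcome
      where
      reached : ∃[ t ] 0 ≤ t × Quiescent (cfg t)
      reached = quiescent-within measureBound 0 (m∸n≤m measureBound (measure (cfg 0)))

      tq : ℕ
      tq = proj₁ reached

      quiet-after : ∀ {t} → tq ≤ t → Quiescent (cfg t)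
      quiet-after = persistent sch Quiescent (λ {t} _ → quiescent-preserved (sch t) (cfg t))
                               (proj₂ (proj₂ reached))

      acted : Fin n → ℕ
      acted v = proj₁ (fair (act v) tq)

      tq≤acted : ∀ v → tq ≤ acted v
      tq≤acted v = proj₁ (proj₂ (fair (act v) tq))

      settled-first : ∀ v → Settled (cfg (suc (acted v))) v
      settled-first v =
        subst (λ e → Settled (step e (cfg (acted v))) v) (sym (proj₂ (proj₂ (fair (act v) tq))))
              (subst (λ c → Settled c v) (sym (quiescent-act v _ quiet))
                     (settles (invariant-run sch (acted v)) quiet v))
        where quiet = quiet-after (tq≤acted v)

      settled-after : ∀ v {t} → suc (acted v) ≤ t → Settled (cfg t) v
      settled-after v = persistent sch (λ c → Settled c v)
        (λ {t} 1+acted≤t → settled-preserved (sch t) v (invariant-run sch t) (quiet-after (≤-trans (tq≤acted v) (≤-trans (n≤1+n _) 1+acted≤t))))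
        (settled-first v)

      horizon : ℕ
      horizon = tq + sum (λ v → suc (acted v))

      outcome : ∀ t → horizon ≤ t →
        Quiescent (cfg t) × UniqueLeader (cfg t) × OrientedRing (cfg t) × sent (cfg t) ≡ n * (4 * M ∸ 1)
      outcome t horizon≤t = quiet
                    , (ℓ , proj₁ (proj₂ (settled ℓ)) refl , λ v → proj₂ (proj₂ (settled v)))
                    , (facing orientation , (λ v → proj₁ (settled v)) , facing-consistent orientation)
                    , sent-final (invariant-run sch t) quiet
        where
        quiet = quiet-after (≤-trans (m≤m+n tq _) horizon≤t)
        settled : ∀ v → Settled (cfg t) v
        settled v = settled-after v (≤-trans (term≤sum (λ v → suc (acted v)) v) (≤-trans (m≤n+m _ tq) horizon≤t))

proposition4p1 : (n : ℕ) .{{_ : NonZero n}} (o : Fin n → Port) (ID : Fin n → ℕ) →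
    (∀ v → 0 < ID v) → Injective _≡_ _≡_ ID →
    (sch : ℕ → Alg.Event n o ID) → Alg.Fair n o ID sch →
    Σ ℕ λ T → ∀ t → T ≤ t →
      Alg.Quiescent n o ID (Alg.run n o ID sch t)
      × Alg.UniqueLeader n o ID (Alg.run n o ID sch t)
      × Alg.OrientedRing n o ID (Alg.run n o ID sch t)
      × sent (Alg.run n o ID sch t) ≡ n * (4 * IDmax n ID ∸ 1)
proposition4p1 n o ID ID-positive ID-injective sch fair =
  Correctness.Liveness.stabilises n o ID ID-positive ID-injective sch fair
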